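{- Let $(A,V)$ and $(B,W)$ be permutation groups on finite sets, neither equal to $I_1$, with $A\in DGR\setminus(GR\cup\{I_2\})$ and $B\in GR$, and suppose $B$ has at least one Or-orbital that is not self-paired. Then $A\times B\in GR$.
   Context: A permutation group $(A,V)$ is a group $A$ of permutations of a set $V$; $I_n$ denotes the trivial group acting on an $n$-element set; groups are considered up to permutation isomorphism. The direct product $A\times B$ acts on $V\times W$ by $(a,b)(x,y)=(a(x),b(y))$. An edge-colored graph on a set $U$ is a function $E$ from the 2-element subsets of $U$ to a finite set of colors, with automorphisms the permutations $\sigma$ of $U$ satisfying $E(\{\sigma(u),\sigma(u')\})=E(\{u,u'\})$ for all distinct $u,u'$; an edge-colored digraph is defined the same way with ordered pairs $(u,u')$, $u\neq u'$, in place of 2-element subsets. $GR$ (resp. $DGR$) is the class of permutation groups that equal the full automorphism group of some edge-colored graph (resp. digraph) on their underlying set. The Or-orbitals of $(B,W)$ are the orbits of $B$ on the set of ordered pairs $(w,w')$ of distinct elements of $W$ under $b(w,w')=(b(w),b(w'))$. Or-orbitals $O_1,O_2$ are paired if $O_2=\{(w',w):(w,w')\in O_1\}$; an Or-orbital is self-paired if it is paired with itself. -}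

module Defs where

open import Level using (Level; suc; _⊔_)
open import Data.Nat using (ℕ)
open import Data.Fin using (Fin)
open import Data.Product using (Σ; ∃; ∃-syntax; _×_; _,_)
open import Data.Unit using (⊤)
open import Relation.Nullary using (¬_)
open import Relation.Binary.PropositionalEquality using (_≡_; _≢_)
open import Function.Bundles using (_↔_; Inverse)
open import Function using (_∘_)

Perm : Set → Set
Perm X = X ↔ X

app : {X : Set} → Perm X → X → X
app σ = Inverse.to σ

record PermGroup (X : Set) : Set₁ where
  field
    mem      : Perm X → Set
    mem-resp : ∀ {σ τ} → (∀ x → app σ x ≡ app τ x) → mem σ → mem τ
    mem-id   : ∀ σ → (∀ x → app σ x ≡ x) → mem σ
    mem-comp : ∀ σ τ ρ → (∀ x → app ρ x ≡ app σ (app τ x)) → mem σ → mem τ → mem ρ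
    mem-inv  : ∀ σ τ → (∀ x → app τ (app σ x) ≡ x) → mem σ → mem τ
open PermGroup public

-- Edge-colored graph on X with colors Fin k: a coloring of the 2-element
-- subsets {u,u'}, represented as a function on ordered pairs that is
-- symmetric on distinct pairs (the diagonal values are irrelevant).
record ColoredGraph (X : Set) (k : ℕ) : Set where
  field
    col  : X → X → Fin k
    symm : ∀ u u' → u ≢ u' → col u u' ≡ col u' u
open ColoredGraph public

-- Edge-colored digraph: a coloring of ordered pairs (u,u'), u ≠ u'
-- (diagonal values irrelevant).
ColoredDigraph : Set → ℕ → Set
ColoredDigraph X k = X → X → Fin k

IsAut : {X : Set} {k : ℕ} → (X → X → Fin k) → Perm X → Set
IsAut E σ = ∀ u u' → u ≢ u' → E (app σ u) (app σ u') ≡ E u u'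

IsAutGroupOf : {X : Set} {k : ℕ} → (Perm X → Set) → (X → X → Fin k) → Set
IsAutGroupOf P E = ∀ σ → (P σ → IsAut E σ) × (IsAut E σ → P σ)

InGR : {X : Set} → (Perm X → Set) → Set
InGR {X} P = Σ ℕ λ k → Σ (ColoredGraph X k) λ G → IsAutGroupOf P (col G)

InDGR : {X : Set} → (Perm X → Set) → Set
InDGR {X} P = Σ ℕ λ k → Σ (ColoredDigraph X k) λ D → IsAutGroupOf P D

-- (A, Fin n) is permutation isomorphic to I_m: n = m and A is trivial.
IsTrivialGroup : {n : ℕ} → PermGroup (Fin n) → ℕ → Set
IsTrivialGroup {n} A m = (n ≡ m) × (∀ σ → mem A σ → ∀ x → app σ x ≡ x)

ProdMem : {V W : Set} → PermGroup V → PermGroup W → Perm (V × W) → Set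
ProdMem A B σ =
  ∃[ a ] ∃[ b ] (mem A a × mem B b ×
    (∀ x y → app σ (x , y) ≡ (app a x , app b y)))

HasNonSelfPairedOrOrbital : {W : Set} → PermGroup W → Set
HasNonSelfPairedOrOrbital {W} B =
  ∃[ w ] ∃[ w' ] (w ≢ w' ×
    ¬ (∃[ b ] (mem B b × app b w ≡ w' × app b w' ≡ w)))

-- A ∈ DGR is the automorphism group of a digraph coloring D of V, and B = Aut(G) for a graph
-- coloring G of W.  Color the pairs of V × W as follows: pairs in a common row V × {y} get one
-- color, pairs in a common column {x} × W get the G-color of their W-coordinates, and a pair
-- (x , y), (x' , y') with x ≠ x', y ≠ y' gets D(x , x') when (y , y') lies in a fixed Or-orbital O
-- of B that is not self-paired, D(x' , x) when (y' , y) does, and a neutral color otherwise.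
-- Since O and its paired orbital are disjoint this is symmetric, i.e. an undirected coloring.
-- An automorphism preserves rows and columns, hence is a product a × b; the columns force b ∈ B,
-- so b preserves O, and the pairs over an element of O then force a to preserve D.
module Submission where

open import Defs
open import Data.Bool using (Bool; true; false; _∧_)
open import Data.Empty using (⊥-elim)
open import Data.Fin using (Fin; zero; suc; _↑ˡ_; _↑ʳ_; splitAt; punchOut)
open import Data.Fin.Properties
  using (_≟_; any?; all?; splitAt-↑ˡ; splitAt-↑ʳ; punchOut-injective; injective⇒≤)
open import Data.Maybe using (Maybe; just; nothing)
open import Data.Maybe.Properties using (just-injective)
open import Data.Nat using (ℕ; zero; suc; _+_)
open import Data.Nat.Properties using (1+n≰n)
open import Data.Product using (_×_; ∃; ∃-syntax; _,_; proj₁; proj₂)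
open import Data.Sum using (inj₁; inj₂)
open import Data.Vec.Functional using (_∷_; head; tail)
open import Function using (_∘_)
open import Function.Bundles using (Inverse; Injection; _⇔_; Equivalence; mk↔ₛ′; mk⇔)
open import Function.Construct.Composition using (_↔-∘_)
open import Function.Construct.Identity using (↔-id)
open import Function.Construct.Symmetry using (↔-sym)
open import Function.Definitions using (Injective)
open import Function.Properties.Inverse using (↔⇒↣)
open import Relation.Binary.Definitions using (Decidable; Asymmetric)
open import Relation.Binary.PropositionalEquality
  using (_≡_; _≢_; _≗_; refl; sym; trans; cong; cong₂; subst₂; module ≡-Reasoning)
open import Relation.Nullary using (¬_; Dec; yes; no; does; contradiction)
open import Relation.Nullary.Decidable using (map′; _×-dec_; _→-dec_; ¬?; dec-true; does-⇔)

app-injective : ∀ {X : Set} (σ : Perm X) → Injective _≡_ _≡_ (app σ)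
app-injective σ = Injection.injective (↔⇒↣ σ)

any-function? : ∀ {k} m (P : (Fin m → Fin k) → Set) →
                (∀ {f g} → f ≗ g → P f → P g) → (∀ f → Dec (P f)) → Dec (∃ P)
any-function? zero P P-resp P? =
  map′ (λ p → _ , p) (λ (f , p) → P-resp (λ ()) p) (P? (λ ()))
any-function? (suc m) P P-resp P? =
  map′ (λ (x , f , p) → x ∷ f , p)
       (λ (f , p) → head f , tail f , P-resp (λ { zero → refl ; (suc i) → refl }) p)
       (any? λ x → any-function? m (P ∘ (x ∷_))
                     (λ f≗g → P-resp λ { zero → refl ; (suc i) → f≗g i })
                     (P? ∘ (x ∷_)))

injective⇒surjective : ∀ {m} {f : Fin m → Fin m} → Injective _≡_ _≡_ f →
                       ∀ j → ∃ λ i → f i ≡ j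
injective⇒surjective {suc m} {f} f-inj j with any? (λ i → f i ≟ j)
... | yes hit = hit
... | no miss = contradiction (injective⇒≤ punched-injective) 1+n≰n
  where
  missed : ∀ i → j ≢ f i
  missed i j≡fi = miss (i , sym j≡fi)

  punched : Fin (suc m) → Fin m
  punched i = punchOut (missed i)

  punched-injective : Injective _≡_ _≡_ punched
  punched-injective {i} {i'} e = f-inj (punchOut-injective (missed i) (missed i') e)

injective⇒perm : ∀ {m} (f : Fin m → Fin m) → Injective _≡_ _≡_ f → Perm (Fin m)
injective⇒perm f f-inj =
  mk↔ₛ′ f (proj₁ ∘ surj) (proj₂ ∘ surj) (λ i → f-inj (proj₂ (surj (f i))))
  where surj = injective⇒surjective f-inj

injective? : ∀ {m} (f : Fin m → Fin m) → Dec (Injective _≡_ _≡_ f)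
injective? f = map′ (λ inj → inj _ _) (λ inj _ _ → inj)
  (all? λ i → all? λ j → (f i ≟ f j) →-dec (i ≟ j))

PreservesColors : ∀ {X : Set} {k} → (X → X → Fin k) → (X → X) → Set
PreservesColors E f = ∀ u u' → u ≢ u' → E (f u) (f u') ≡ E u u'

module _ {m k} (E : Fin m → Fin m → Fin k) where

  preservesColors? : (f : Fin m → Fin m) → Dec (PreservesColors E f)
  preservesColors? f =
    all? λ u → all? λ u' → ¬? (u ≟ u') →-dec (E (f u) (f u') ≟ E u u')

  any-automorphism? : (P : (Fin m → Fin m) → Set) → (∀ {f g} → f ≗ g → P f → P g) →
                      (∀ f → Dec (P f)) → Dec (∃[ σ ] IsAut E σ × P (app σ))
  any-automorphism? P P-resp P? =
    map′ (λ (f , f-inj , f-pres , p) → injective⇒perm f f-inj , f-pres , p)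
         (λ (σ , σ-aut , p) → app σ , (λ {_} {_} → app-injective σ) , σ-aut , p)
         (any-function? m Q Q-resp Q?)
    where
    Q : (Fin m → Fin m) → Set
    Q f = Injective _≡_ _≡_ f × PreservesColors E f × P f

    Q-resp : ∀ {f g} → f ≗ g → Q f → Q g
    Q-resp {f} {g} f≗g (f-inj , f-pres , p) =
      (λ {i} {j} e → f-inj (trans (f≗g i) (trans e (sym (f≗g j))))) ,
      (λ u u' u≢u' → trans (cong₂ E (sym (f≗g u)) (sym (f≗g u'))) (f-pres u u' u≢u')) ,
      P-resp f≗g p

    Q? : ∀ f → Dec (Q f)
    Q? f = injective? f ×-dec preservesColors? f ×-dec P? f

module _ {W : Set} (B : PermGroup W) where

  InOrbital : W → W → W → W → Set
  InOrbital w w' y y' = ∃[ b ] (mem B b × app b w ≡ y × app b w' ≡ y')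

  module _ {w w' : W} where

    inOrbital-refl : InOrbital w w' w w'
    inOrbital-refl = ↔-id _ , mem-id B _ (λ _ → refl) , refl , refl

    inOrbital-map : ∀ {b y y'} → mem B b →
                    InOrbital w w' y y' → InOrbital w w' (app b y) (app b y')
    inOrbital-map {b} b∈B (c , c∈B , refl , refl) =
      b ↔-∘ c , mem-comp B b c _ (λ _ → refl) b∈B c∈B , refl , refl

    inOrbital-unmap : ∀ {b y y'} → mem B b →
                      InOrbital w w' (app b y) (app b y') → InOrbital w w' y y'
    inOrbital-unmap {b} {y} {y'} b∈B o =
      subst₂ (InOrbital w w') (Inverse.strictlyInverseʳ b y) (Inverse.strictlyInverseʳ b y')
        (inOrbital-map (mem-inv B b (↔-sym b) (Inverse.strictlyInverseʳ b) b∈B) o)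

    inOrbital-asym : ¬ InOrbital w w' w' w → Asymmetric (InOrbital w w')
    inOrbital-asym not-self-paired (c , c∈B , refl , refl) (d , d∈B , dw , dw') =
      not-self-paired (inOrbital-unmap c∈B (d , d∈B , dw , dw'))

inOrbital? : ∀ {m k} {B : PermGroup (Fin m)} {E : Fin m → Fin m → Fin k} →
             IsAutGroupOf (mem B) E → ∀ w w' → Decidable (InOrbital B w w')
inOrbital? {E = E} B=AutE w w' y y' =
  map′ (λ (σ , σ-aut , p) → σ , proj₂ (B=AutE σ) σ-aut , p)
       (λ (σ , σ∈B , p) → σ , proj₁ (B=AutE σ) σ∈B , p)
       (any-automorphism? E (λ f → f w ≡ y × f w' ≡ y')
          (λ f≗g (fw , fw') → trans (sym (f≗g w)) fw , trans (sym (f≗g w')) fw')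
          (λ f → (f w ≟ y) ×-dec (f w' ≟ y')))

data ProductColor (k₁ k₂ : ℕ) : Set where
  horizontal : ProductColor k₁ k₂
  vertical   : Fin k₂ → ProductColor k₁ k₂
  diagonal   : Maybe (Fin k₁) → ProductColor k₁ k₂

module _ {k₁ k₂ : ℕ} where

  encode : ProductColor k₁ k₂ → Fin (suc (k₂ + suc k₁))
  encode horizontal           = zero
  encode (vertical c)         = suc (c ↑ˡ suc k₁)
  encode (diagonal nothing)   = suc (k₂ ↑ʳ zero)
  encode (diagonal (just c))  = suc (k₂ ↑ʳ suc c)

  decode : Fin (suc (k₂ + suc k₁)) → ProductColor k₁ k₂
  decode zero = horizontal
  decode (suc i) with splitAt k₂ i
  ... | inj₁ c       = vertical c
  ... | inj₂ zero    = diagonal nothing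
  ... | inj₂ (suc c) = diagonal (just c)

  decode-encode : ∀ c → decode (encode c) ≡ c
  decode-encode horizontal = refl
  decode-encode (vertical c) rewrite splitAt-↑ˡ k₂ c (suc k₁) = refl
  decode-encode (diagonal nothing) rewrite splitAt-↑ʳ k₂ (suc k₁) zero = refl
  decode-encode (diagonal (just c)) rewrite splitAt-↑ʳ k₂ (suc k₁) (suc c) = refl

  encode-injective : Injective _≡_ _≡_ encode
  encode-injective {c} {c'} e =
    trans (sym (decode-encode c)) (trans (cong decode e) (decode-encode c'))

  vertical-injective : ∀ {c c'} → vertical {k₁} {k₂} c ≡ vertical c' → c ≡ c'
  vertical-injective refl = refl

  diagonal-injective : ∀ {d d'} → diagonal {k₁} {k₂} d ≡ diagonal d' → d ≡ d'
  diagonal-injective refl = refl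

does-∧-false : ∀ {P Q : Set} → (P → ¬ Q) → (p? : Dec P) (q? : Dec Q) → does p? ∧ does q? ≡ false
does-∧-false P⇒¬Q (yes p) (yes q) = ⊥-elim (P⇒¬Q p q)
does-∧-false P⇒¬Q (yes _) (no _)  = refl
does-∧-false P⇒¬Q (no _)  _       = refl

module ProductColoring
  {n m k₁ k₂ : ℕ} (D : ColoredDigraph (Fin n) k₁) (G : ColoredGraph (Fin m) k₂)
  {Arc : Fin m → Fin m → Set} (Arc? : Decidable Arc) (Arc-asym : Asymmetric Arc)
  (Arc-invariant : ∀ b → IsAut (col G) b → ∀ y y' → Arc (app b y) (app b y') ⇔ Arc y y')
  where

  open ≡-Reasoning

  arcColor : (forward backward : Bool) → Fin n → Fin n → Maybe (Fin k₁)
  arcColor true  _     x x' = just (D x x')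
  arcColor false true  x x' = just (D x' x)
  arcColor false false _ _  = nothing

  arcColor-swap : ∀ p q {x x'} → p ∧ q ≡ false → arcColor q p x' x ≡ arcColor p q x x'
  arcColor-swap true  true  ()
  arcColor-swap true  false _ = refl
  arcColor-swap false true  _ = refl
  arcColor-swap false false _ = refl

  arcColor-map : ∀ {a} → PreservesColors D a → ∀ {x x'} → x ≢ x' →
                 ∀ p q → arcColor p q (a x) (a x') ≡ arcColor p q x x'
  arcColor-map a-pres x≢x' true  _     = cong just (a-pres _ _ x≢x')
  arcColor-map a-pres x≢x' false true  = cong just (a-pres _ _ (x≢x' ∘ sym))
  arcColor-map a-pres x≢x' false false = refl

  diagonalColor : Fin m → Fin m → Fin n → Fin n → Maybe (Fin k₁)
  diagonalColor y y' = arcColor (does (Arc? y y')) (does (Arc? y' y))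

  diagonalColor-swap : ∀ y y' x x' → diagonalColor y' y x' x ≡ diagonalColor y y' x x'
  diagonalColor-swap y y' x x' =
    arcColor-swap (does (Arc? y y')) (does (Arc? y' y)) (does-∧-false Arc-asym (Arc? y y') (Arc? y' y))

  diagonalColor-arc : ∀ {y y'} → Arc y y' → ∀ x x' → diagonalColor y y' x x' ≡ just (D x x')
  diagonalColor-arc {y} {y'} arc x x' =
    cong (λ p → arcColor p (does (Arc? y' y)) x x') (dec-true (Arc? y y') arc)

  diagonalColor-map : ∀ {a b} → PreservesColors D a → IsAut (col G) b → ∀ y y' {x x'} → x ≢ x' →
                      diagonalColor (app b y) (app b y') (a x) (a x') ≡ diagonalColor y y' x x'
  diagonalColor-map {a} {b} a-pres b-aut y y' {x} {x'} x≢x' =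
    trans (cong₂ (λ p q → arcColor p q (a x) (a x'))
                 (does-⇔ (Arc-invariant b b-aut y y') (Arc? _ _) (Arc? y y'))
                 (does-⇔ (Arc-invariant b b-aut y' y) (Arc? _ _) (Arc? y' y)))
          (arcColor-map a-pres x≢x' _ _)

  color : Fin n × Fin m → Fin n × Fin m → ProductColor k₁ k₂
  color (x , y) (x' , y') with y ≟ y' | x ≟ x'
  ... | yes _ | _     = horizontal
  ... | no _  | yes _ = vertical (col G y y')
  ... | no _  | no _  = diagonal (diagonalColor y y' x x')

  color-horizontal : ∀ {x x' y y'} → y ≡ y' → color (x , y) (x' , y') ≡ horizontal
  color-horizontal {x} {x'} {y} {y'} y≡y' with y ≟ y' | x ≟ x'
  ... | yes _    | _ = refl
  ... | no y≢y'  | _ = contradiction y≡y' y≢y'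

  color-horizontal⁻¹ : ∀ {x x' y y'} → color (x , y) (x' , y') ≡ horizontal → y ≡ y'
  color-horizontal⁻¹ {x} {x'} {y} {y'} e with y ≟ y' | x ≟ x'
  color-horizontal⁻¹ e          | yes y≡y' | _     = y≡y'
  color-horizontal⁻¹ ()         | no _     | yes _
  color-horizontal⁻¹ ()         | no _     | no _

  color-vertical : ∀ {x y y'} → y ≢ y' → color (x , y) (x , y') ≡ vertical (col G y y')
  color-vertical {x} {y} {y'} y≢y' with y ≟ y' | x ≟ x
  ... | yes y≡y' | _       = contradiction y≡y' y≢y'
  ... | no _     | yes _   = refl
  ... | no _     | no x≢x  = contradiction refl x≢x

  color-vertical⁻¹ : ∀ {x x' y y' c} → color (x , y) (x' , y') ≡ vertical c → x ≡ x'
  color-vertical⁻¹ {x} {x'} {y} {y'} e with y ≟ y' | x ≟ x'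
  color-vertical⁻¹ ()         | yes _ | _
  color-vertical⁻¹ e          | no _  | yes x≡x' = x≡x'
  color-vertical⁻¹ ()         | no _  | no _

  color-diagonal : ∀ {x x' y y'} → y ≢ y' → x ≢ x' →
                   color (x , y) (x' , y') ≡ diagonal (diagonalColor y y' x x')
  color-diagonal {x} {x'} {y} {y'} y≢y' x≢x' with y ≟ y' | x ≟ x'
  ... | yes y≡y' | _        = contradiction y≡y' y≢y'
  ... | no _     | yes x≡x' = contradiction x≡x' x≢x'
  ... | no _     | no _     = refl

  color-sym : ∀ p q → color p q ≡ color q p
  color-sym (x , y) (x' , y') with y ≟ y' | x ≟ x'
  ... | yes y≡y' | _        = sym (color-horizontal (sym y≡y'))
  ... | no y≢y'  | yes refl =
    trans (cong vertical (symm G y y' y≢y')) (sym (color-vertical (y≢y' ∘ sym)))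
  ... | no y≢y'  | no x≢x'  =
    trans (cong diagonal (sym (diagonalColor-swap y y' x x')))
          (sym (color-diagonal (y≢y' ∘ sym) (x≢x' ∘ sym)))

  color-map : ∀ {a b} → IsAut D a → IsAut (col G) b → ∀ x x' y y' →
              color (app a x , app b y) (app a x' , app b y') ≡ color (x , y) (x' , y')
  color-map {a} {b} a-aut b-aut x x' y y' with y ≟ y' | x ≟ x'
  ... | yes refl | _        = color-horizontal refl
  ... | no y≢y'  | yes refl =
    trans (color-vertical (y≢y' ∘ app-injective b)) (cong vertical (b-aut y y' y≢y'))
  ... | no y≢y'  | no x≢x'  =
    trans (color-diagonal (y≢y' ∘ app-injective b) (x≢x' ∘ app-injective a))
          (cong diagonal (diagonalColor-map {app a} {b} a-aut b-aut y y' x≢x'))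

  productGraph : ColoredGraph (Fin n × Fin m) (suc (k₂ + suc k₁))
  productGraph = record
    { col  = λ p q → encode (color p q)
    ; symm = λ p q _ → cong encode (color-sym p q)
    }

  product-isAut : ∀ {σ a b} → IsAut D a → IsAut (col G) b →
                  (∀ x y → app σ (x , y) ≡ (app a x , app b y)) → IsAut (col productGraph) σ
  product-isAut {σ} {a} {b} a-aut b-aut σ-split (x , y) (x' , y') _ =
    trans (cong₂ (λ p q → encode (color p q)) (σ-split x y) (σ-split x' y'))
          (cong encode (color-map {a} {b} a-aut b-aut x x' y y'))

  module Decomposition (σ : Perm (Fin n × Fin m)) (σ-aut : IsAut (col productGraph) σ)
                       (x₀ : Fin n) (y₀ : Fin m) where

    σ-color : ∀ p q → p ≢ q → color (app σ p) (app σ q) ≡ color p q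
    σ-color p q p≢q = encode-injective (σ-aut p q p≢q)

    rows-preserved : ∀ x x' y → proj₂ (app σ (x , y)) ≡ proj₂ (app σ (x' , y))
    rows-preserved x x' y with x ≟ x'
    ... | yes refl = refl
    ... | no x≢x'  =
      color-horizontal⁻¹ (trans (σ-color _ _ (x≢x' ∘ cong proj₁)) (color-horizontal refl))

    columns-preserved : ∀ x y y' → proj₁ (app σ (x , y)) ≡ proj₁ (app σ (x , y'))
    columns-preserved x y y' with y ≟ y'
    ... | yes refl = refl
    ... | no y≢y'  =
      color-vertical⁻¹ (trans (σ-color _ _ (y≢y' ∘ cong proj₂)) (color-vertical y≢y'))

    σV : Fin n → Fin n
    σV x = proj₁ (app σ (x , y₀))

    σW : Fin m → Fin m
    σW y = proj₂ (app σ (x₀ , y))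

    σ-split : ∀ x y → app σ (x , y) ≡ (σV x , σW y)
    σ-split x y = cong₂ _,_ (columns-preserved x y y₀) (rows-preserved x x₀ y)

    σ-split-injective : ∀ {x x' y y'} → (σV x , σW y) ≡ (σV x' , σW y') → (x , y) ≡ (x' , y')
    σ-split-injective {x} {x'} {y} {y'} e =
      app-injective σ (trans (σ-split x y) (trans e (sym (σ-split x' y'))))

    σV-injective : Injective _≡_ _≡_ σV
    σV-injective e = cong proj₁ (σ-split-injective {y = y₀} (cong₂ _,_ e refl))

    σW-injective : Injective _≡_ _≡_ σW
    σW-injective e = cong proj₂ (σ-split-injective {x = x₀} (cong₂ _,_ refl e))

    σ-split-color : ∀ {x x' y y'} → (x , y) ≢ (x' , y') →
                    color (σV x , σW y) (σV x' , σW y') ≡ color (x , y) (x' , y')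
    σ-split-color {x} {x'} {y} {y'} p≢q =
      trans (cong₂ color (sym (σ-split x y)) (sym (σ-split x' y'))) (σ-color _ _ p≢q)

    σW-aut : PreservesColors (col G) σW
    σW-aut y y' y≢y' = vertical-injective (begin
      vertical (col G (σW y) (σW y'))         ≡⟨ sym (color-vertical (y≢y' ∘ σW-injective)) ⟩
      color (σV x₀ , σW y) (σV x₀ , σW y')    ≡⟨ σ-split-color (y≢y' ∘ cong proj₂) ⟩
      color (x₀ , y) (x₀ , y')                ≡⟨ color-vertical y≢y' ⟩
      vertical (col G y y')                   ∎)

    σWᵖ : Perm (Fin m)
    σWᵖ = injective⇒perm σW σW-injective

    σVᵖ : Perm (Fin n)
    σVᵖ = injective⇒perm σV σV-injective

    σV-aut : ∀ {y₁} → Arc y₀ y₁ → PreservesColors D σV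
    σV-aut {y₁} arc x x' x≢x' = just-injective (diagonal-injective (begin
      diagonal (just (D (σV x) (σV x')))
        ≡⟨ cong diagonal (sym (diagonalColor-arc σ-arc _ _)) ⟩
      diagonal (diagonalColor (σW y₀) (σW y₁) (σV x) (σV x'))
        ≡⟨ sym (color-diagonal (y₀≢y₁ ∘ σW-injective) (x≢x' ∘ σV-injective)) ⟩
      color (σV x , σW y₀) (σV x' , σW y₁)
        ≡⟨ σ-split-color (x≢x' ∘ cong proj₁) ⟩
      color (x , y₀) (x' , y₁)
        ≡⟨ color-diagonal y₀≢y₁ x≢x' ⟩
      diagonal (diagonalColor y₀ y₁ x x')
        ≡⟨ cong diagonal (diagonalColor-arc arc x x') ⟩
      diagonal (just (D x x'))
        ∎))
      where
      y₀≢y₁ : y₀ ≢ y₁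
      y₀≢y₁ refl = Arc-asym arc arc

      σ-arc : Arc (σW y₀) (σW y₁)
      σ-arc = Equivalence.from (Arc-invariant σWᵖ σW-aut y₀ y₁) arc

  productGraph-isAutGroupOf : (A : PermGroup (Fin n)) (B : PermGroup (Fin m)) →
    IsAutGroupOf (mem A) D → IsAutGroupOf (mem B) (col G) →
    Fin n → ∀ {y₀ y₁} → Arc y₀ y₁ → IsAutGroupOf (ProdMem A B) (col productGraph)
  productGraph-isAutGroupOf A B A=AutD B=AutG x₀ {y₀} arc σ =
    (λ (a , b , a∈A , b∈B , σ-split) →
       product-isAut {σ} {a} {b} (proj₁ (A=AutD a) a∈A) (proj₁ (B=AutG b) b∈B) σ-split) ,
    (λ σ-aut → let open Decomposition σ σ-aut x₀ y₀ in
       σVᵖ , σWᵖ , proj₂ (A=AutD σVᵖ) (σV-aut arc) , proj₂ (B=AutG σWᵖ) σW-aut , σ-split)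

inGR-Fin0 : (A : PermGroup (Fin 0)) → InGR (mem A)
inGR-Fin0 A = 0 , record { col = λ () ; symm = λ () } , λ σ → (λ _ ()) , (λ _ → mem-id A σ (λ ()))

lemma3p7 : (n m : ℕ) (A : PermGroup (Fin n)) (B : PermGroup (Fin m)) →
    ¬ IsTrivialGroup A 1 → ¬ IsTrivialGroup B 1 →
    InDGR (mem A) → ¬ InGR (mem A) → ¬ IsTrivialGroup A 2 →
    InGR (mem B) → HasNonSelfPairedOrOrbital B →
    InGR (ProdMem A B)
lemma3p7 zero _ A _ _ _ _ A∉GR _ _ _ = ⊥-elim (A∉GR (inGR-Fin0 A))
lemma3p7 (suc n) m A B _ _ (k₁ , D , A=AutD) _ _ (k₂ , G , B=AutG) (w₀ , w₁ , _ , not-self-paired) =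
  _ , productGraph , productGraph-isAutGroupOf A B A=AutD B=AutG zero (inOrbital-refl B)
  where
  orbital-invariant : ∀ b → IsAut (col G) b → ∀ y y' →
                      InOrbital B w₀ w₁ (app b y) (app b y') ⇔ InOrbital B w₀ w₁ y y'
  orbital-invariant b b-aut _ _ = mk⇔ (inOrbital-unmap B b∈B) (inOrbital-map B b∈B)
    where b∈B = proj₂ (B=AutG b) b-aut

  open ProductColoring D G (inOrbital? {B = B} {E = col G} B=AutG w₀ w₁) (inOrbital-asym B not-self-paired)
                           orbital-invariant
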